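{- Let $W$ be the set of all maximal theories of the logic $\mathbf{G_0}$, and let $M=\langle W,\mu,\mathbf{f},\mathcal{N},V\rangle$ be the canonical model described in the context (for an arbitrary choice of the function $\mathbf{f}$ satisfying the stated condition). Then for every formula $\gamma$ and every $w\in W$: $w\Vdash\gamma$ if and only if $\gamma\in w$.
   Context: Formulas are built from a countable set $PV$ of propositional variables using $\bot,\lnot,\land,\lor,\to$ and two unary modal operators $\Box$ and $\blacksquare$. The logic $\mathbf{G_0}$ is the smallest set of formulas containing all instances (in this language) of classical propositional tautologies and all instances of $\Box(\varphi\land\psi)\to(\Box\varphi\land\Box\psi)$, $\Box\varphi\to\varphi$, $\Box\varphi\to\Box\Box\varphi$, and closed under modus ponens and the rules: from $\varphi\leftrightarrow\psi$ infer $\Box\varphi\leftrightarrow\Box\psi$; from $\varphi\leftrightarrow\psi$ infer $\blacksquare\varphi\leftrightarrow\blacksquare\psi$. A maximal theory is a maximal $\mathbf{G_0}$-consistent set of formulas (containing $\mathbf{G_0}$ and closed under modus ponens). For a formula $\gamma$ put $\widehat{\gamma}=\{w\in W:\gamma\in w\}$. The canonical model: $V(q)=\widehat{q}$ for $q\in PV$; $\mu$ is the family of all unions of (possibly empty) subfamilies of the basic sets $\widehat{\Box\varphi}$, $\varphi$ a formula (so $\mu$ contains $\emptyset$ and is closed under unions); $\bigcup\mu$ is the union of all members of $\mu$; $Y_1$ is the set of those $w\in W$ for which there is $v\in\bigcup\mu$ such that for all formulas $\varphi$: $\Box\varphi\in v\iff\blacksquare\varphi\in w$; $Y_2=W\setminus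 Y_1$; $\mathbf{f}:Y_1\to\bigcup\mu$ assigns to each $w\in Y_1$ some such $v$; $\mathcal{N}$ assigns to each $w\in Y_2$ the family $\mathcal{N}_w=\{\widehat{\varphi}:\blacksquare\varphi\in w\}$. Satisfaction: $w\Vdash q$ iff $w\in V(q)$; Boolean connectives classically; writing $\|\varphi\|=\{z\in W:z\Vdash\varphi\}$: $w\Vdash\Box\varphi$ iff there is $X\in\mu$ with $w\in X\subseteq\|\varphi\|$; for $w\in Y_1$, $w\Vdash\blacksquare\varphi$ iff there is $X\in\mu$ with $\mathbf{f}(w)\in X\subseteq\|\varphi\|$; for $w\in Y_2$, $w\Vdash\blacksquare\varphi$ iff $\|\varphi\|\in\mathcal{N}_w$. -}

module Defs where

open import Level using (Level; Lift; lift; 0ℓ) renaming (suc to lsuc)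
open import Data.Nat using (ℕ)
open import Data.Bool using (Bool; true; false; not; _∧_; _∨_)
open import Data.Product using (Σ; _×_; _,_; Σ-syntax)
open import Data.Sum using (_⊎_)
open import Data.Empty using (⊥)
open import Relation.Nullary using (¬_)
open import Relation.Binary.PropositionalEquality using (_≡_)

data Fm : Set where
  var  : ℕ → Fm
  ⊥'   : Fm
  ¬'_  : Fm → Fm
  _∧'_ : Fm → Fm → Fm
  _∨'_ : Fm → Fm → Fm
  _⇒_  : Fm → Fm → Fm
  □_   : Fm → Fm
  ■_   : Fm → Fm

infixr 6 _∧'_
infixr 5 _∨'_
infixr 4 _⇒_
infix 3 _⇔'_
infix 7 ¬'_ □_ ■_

_⇔'_ : Fm → Fm → Fm
φ ⇔' ψ = (φ ⇒ ψ) ∧' (ψ ⇒ φ)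

-- Boolean evaluation treating variables and modal formulas (□φ, ■φ) as atoms
-- (their truth value given by the valuation v).
_⇒ᵇ_ : Bool → Bool → Bool
a ⇒ᵇ b = not a ∨ b

eval : (Fm → Bool) → Fm → Bool
eval v (var q)  = v (var q)
eval v ⊥'       = false
eval v (¬' φ)   = not (eval v φ)
eval v (φ ∧' ψ) = eval v φ ∧ eval v ψ
eval v (φ ∨' ψ) = eval v φ ∨ eval v ψ
eval v (φ ⇒ ψ)  = eval v φ ⇒ᵇ eval v ψ
eval v (□ φ)    = v (□ φ)
eval v (■ φ)    = v (■ φ)

-- instances (in this language) of classical propositional tautologies
Taut : Fm → Set
Taut φ = (v : Fm → Bool) → eval v φ ≡ true

data G0 : Fm → Set where
  taut : ∀ {φ} → Taut φ → G0 φ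
  axM  : ∀ {φ ψ} → G0 (□ (φ ∧' ψ) ⇒ (□ φ ∧' □ ψ))
  axT  : ∀ {φ} → G0 (□ φ ⇒ φ)
  ax4  : ∀ {φ} → G0 (□ φ ⇒ □ □ φ)
  mp   : ∀ {φ ψ} → G0 (φ ⇒ ψ) → G0 φ → G0 ψ
  reB  : ∀ {φ ψ} → G0 (φ ⇔' ψ) → G0 (□ φ ⇔' □ ψ)
  reBB : ∀ {φ ψ} → G0 (φ ⇔' ψ) → G0 (■ φ ⇔' ■ ψ)

data Ded (Δ : Fm → Set) : Fm → Set where
  thm : ∀ {φ} → G0 φ → Ded Δ φ
  hyp : ∀ {φ} → Δ φ → Ded Δ φ
  mpD : ∀ {φ ψ} → Ded Δ (φ ⇒ ψ) → Ded Δ φ → Ded Δ ψ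

Consistent : (Fm → Set) → Set
Consistent Δ = ¬ Ded Δ ⊥'

record MaxTheory : Set₁ where
  field
    mem        : Fm → Set
    containsG0 : ∀ {φ} → G0 φ → mem φ
    closedMP   : ∀ {φ ψ} → mem (φ ⇒ ψ) → mem φ → mem ψ
    consistent : Consistent mem
    maximal    : (Δ : Fm → Set) → (∀ {φ} → mem φ → Δ φ) → Consistent Δ →
                 ∀ {φ} → Δ φ → mem φ
open MaxTheory public

W : Set₁
W = MaxTheory

record _⟺_ {a b : Level} (A : Set a) (B : Set b) : Set (a Level.⊔ b) where
  constructor mk⟺
  field
    to   : A → B
    from : B → A

hat : Fm → W → Set
hat γ w = mem w γ

-- μ: unions of subfamilies of the basic sets hat(□φ); a subfamily is given
-- by a set S of formulas, and X is in μ iff X = ⋃_{φ ∈ S} hat(□φ)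
μ : (W → Set) → Set₁
μ X = Σ[ S ∈ (Fm → Set) ] ((w : W) → X w ⟺ (Σ[ φ ∈ Fm ] (S φ × hat (□ φ) w)))

⋃μ : W → Set₁
⋃μ w = Σ[ X ∈ (W → Set) ] (μ X × X w)

Corr : W → W → Set
Corr v w = (φ : Fm) → hat (□ φ) v ⟺ hat (■ φ) w

Y₁ : W → Set₁
Y₁ w = Σ[ v ∈ W ] (⋃μ v × Corr v w)

Y₂ : W → Set₁
Y₂ w = ¬ Y₁ w

-- admissible choice functions f : Y₁ → ⋃μ (values outside Y₁ irrelevant)
IsChoice : (W → W) → Set₁
IsChoice f = (w : W) → Y₁ w → ⋃μ (f w) × Corr (f w) w

sat : (W → W) → Fm → W → Set₁
sat f (var q)  w = Lift (lsuc 0ℓ) (hat (var q) w)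
sat f ⊥'       w = Lift (lsuc 0ℓ) ⊥
sat f (¬' φ)   w = ¬ sat f φ w
sat f (φ ∧' ψ) w = sat f φ w × sat f ψ w
sat f (φ ∨' ψ) w = sat f φ w ⊎ sat f ψ w
sat f (φ ⇒ ψ)  w = sat f φ w → sat f ψ w
sat f (□ φ)    w = Σ[ X ∈ (W → Set) ] (μ X × X w × ((z : W) → X z → sat f φ z))
sat f (■ φ)    w =
    (Y₁ w × (Σ[ X ∈ (W → Set) ] (μ X × X (f w) × ((z : W) → X z → sat f φ z))))
  ⊎ (Y₂ w × (Σ[ ψ ∈ Fm ] (hat (■ ψ) w × ((z : W) → hat ψ z ⟺ sat f φ z))))

-- The Boolean cases only need that
-- maximal theories are prime and negation-complete, which holds once membership
-- is decidable. The modal cases reduce, through the Lindenbaum lemma, to the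
-- fact that a formula lying in every maximal theory is a theorem of G₀. For □:
-- an open set X ∈ μ containing v inside ‖φ‖ contains a basic set ̂□χ ∋ v with
-- ̂□χ ⊆ ̂φ, so □χ → φ is a theorem and □φ ∈ v follows from axiom 4 and the
-- monotonicity of □ (M together with RE). For ■ at w ∈ Y₁ the correspondence
-- with f(w) turns ■φ ∈ w into □φ ∈ f(w); at w ∈ Y₂ two formulas with the same
-- truth set are provably equivalent, so the ■-rule makes 𝒩_w well defined.
module Submission where

open import Defs
open import Level using (Level; Lift; 0ℓ; lift; lower) renaming (suc to lsuc)
open import Axiom.ExcludedMiddle using (ExcludedMiddle)
open import Data.Nat using (ℕ; zero; suc; _≤_; _≤′_; ≤′-refl; ≤′-step; _⊔_)
open import Data.Nat.Properties using (≤⇒≤′; m≤m⊔n; m≤n⊔m)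
open import Data.Bool using (Bool; true; false; T; not; _∧_; _∨_)
open import Data.Bool.Properties using (T-≡)
open import Data.Product using (_×_; _,_; proj₁; proj₂; Σ-syntax; ∃-syntax)
open import Data.Product.Function.NonDependent.Propositional using (_×-⇔_)
open import Data.Sum using (_⊎_; inj₁; inj₂)
open import Data.Sum.Function.Propositional using (_⊎-⇔_)
open import Data.Empty using (⊥-elim)
open import Data.List using (List; []; _∷_; concatMap)
open import Data.List.Membership.Propositional using (_∈_; lose)
open import Data.List.Membership.Propositional.Properties using (∈-concatMap⁺)
open import Data.List.Relation.Unary.Any using (here; there)
open import Function using (_∘_; _⇔_; mk⇔; Equivalence)
open import Function.Construct.Composition using (_⇔-∘_)
open import Function.Related.TypeIsomorphisms using (→-cong-⇔; ¬-cong-⇔)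
open import Relation.Nullary using (¬_; Dec; yes; no)
open import Relation.Nullary.Decidable using (map′)
open import Relation.Unary using (Pred; _⊆_; _∪_; ｛_｝; ∅; ⋃)
open import Relation.Binary.PropositionalEquality using (_≡_; refl)

open Equivalence using (to; from)

private
  variable
    ℓ ℓ′ : Level
    A B C P : Set ℓ
    a b c φ ψ : Fm
    Δ Δ′ : Pred Fm 0ℓ

⟺⇒⇔ : A ⟺ B → A ⇔ B
⟺⇒⇔ (mk⟺ f g) = mk⇔ f g

cases-⇔ : Dec P → (P → A ⇔ C) → (¬ P → B ⇔ C) → ((P × A) ⊎ (¬ P × B)) ⇔ C
cases-⇔ {P = P} {A = A} {C = C} {B = B} P? A⇔C B⇔C = mk⇔ forward (backward P?)
  where
  forward : (P × A) ⊎ (¬ P × B) → C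
  forward (inj₁ (p , x))  = to (A⇔C p) x
  forward (inj₂ (¬p , y)) = to (B⇔C ¬p) y
  backward : Dec P → C → (P × A) ⊎ (¬ P × B)
  backward (yes p) z = inj₁ (p , from (A⇔C p) z)
  backward (no ¬p) z = inj₂ (¬p , from (B⇔C ¬p) z)

chain-mono : {A : Set} (Q : ℕ → Pred A ℓ) → (∀ k → Q k ⊆ Q (suc k)) →
             ∀ {j k} → j ≤ k → Q j ⊆ Q k
chain-mono Q step j≤k = go (≤⇒≤′ j≤k)
  where
  go : ∀ {j k} → j ≤′ k → Q j ⊆ Q k
  go ≤′-refl         x = x
  go (≤′-step j≤′k) x = step _ (go j≤′k x)

Valid₁ : (Bool → Bool) → Set
Valid₁ g = T (g true) × T (g false)

Valid₂ : (Bool → Bool → Bool) → Set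
Valid₂ g = Valid₁ (g true) × Valid₁ (g false)

Valid₃ : (Bool → Bool → Bool → Bool) → Set
Valid₃ g = Valid₂ (g true) × Valid₂ (g false)

valid₁ : ∀ g → Valid₁ g → ∀ x → g x ≡ true
valid₁ g (t , _) true  = to T-≡ t
valid₁ g (_ , f) false = to T-≡ f

valid₂ : ∀ g → Valid₂ g → ∀ x y → g x y ≡ true
valid₂ g (t , _) true  = valid₁ (g true) t
valid₂ g (_ , f) false = valid₁ (g false) f

valid₃ : ∀ g → Valid₃ g → ∀ x y z → g x y z ≡ true
valid₃ g (t , _) true  = valid₂ (g true) t
valid₃ g (_ , f) false = valid₂ (g false) f

-- The underscore is the truth table: each of its entries reduces to T true = ⊤
-- and is found by eta.
taut-K : ∀ a b → Taut (a ⇒ b ⇒ a)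
taut-K a b v = valid₂ (λ x y → x ⇒ᵇ (y ⇒ᵇ x)) _ (eval v a) (eval v b)

taut-S : ∀ a b c → Taut ((a ⇒ b ⇒ c) ⇒ (a ⇒ b) ⇒ a ⇒ c)
taut-S a b c v =
  valid₃ (λ x y z → (x ⇒ᵇ (y ⇒ᵇ z)) ⇒ᵇ ((x ⇒ᵇ y) ⇒ᵇ (x ⇒ᵇ z))) _
         (eval v a) (eval v b) (eval v c)

taut-I : ∀ a → Taut (a ⇒ a)
taut-I a v = valid₁ (λ x → x ⇒ᵇ x) _ (eval v a)

taut-¬¬-elim : ∀ a → Taut ((¬' a ⇒ ⊥') ⇒ a)
taut-¬¬-elim a v = valid₁ (λ x → (not x ⇒ᵇ false) ⇒ᵇ x) _ (eval v a)

taut-explosion : ∀ a b → Taut (¬' a ⇒ a ⇒ b)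
taut-explosion a b v = valid₂ (λ x y → not x ⇒ᵇ (x ⇒ᵇ y)) _ (eval v a) (eval v b)

taut-∧-proj₁ : ∀ a b → Taut (a ∧' b ⇒ a)
taut-∧-proj₁ a b v = valid₂ (λ x y → (x ∧ y) ⇒ᵇ x) _ (eval v a) (eval v b)

taut-∧-proj₂ : ∀ a b → Taut (a ∧' b ⇒ b)
taut-∧-proj₂ a b v = valid₂ (λ x y → (x ∧ y) ⇒ᵇ y) _ (eval v a) (eval v b)

taut-∧-intro : ∀ a b → Taut (a ⇒ b ⇒ a ∧' b)
taut-∧-intro a b v = valid₂ (λ x y → x ⇒ᵇ (y ⇒ᵇ (x ∧ y))) _ (eval v a) (eval v b)

taut-∨-inj₁ : ∀ a b → Taut (a ⇒ a ∨' b)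
taut-∨-inj₁ a b v = valid₂ (λ x y → x ⇒ᵇ (x ∨ y)) _ (eval v a) (eval v b)

taut-∨-inj₂ : ∀ a b → Taut (b ⇒ a ∨' b)
taut-∨-inj₂ a b v = valid₂ (λ x y → y ⇒ᵇ (x ∨ y)) _ (eval v a) (eval v b)

taut-∨-syllogism : ∀ a b → Taut (a ∨' b ⇒ ¬' a ⇒ b)
taut-∨-syllogism a b v =
  valid₂ (λ x y → (x ∨ y) ⇒ᵇ (not x ⇒ᵇ y)) _ (eval v a) (eval v b)

Ded-mono : Δ ⊆ Δ′ → Ded Δ ⊆ Ded Δ′
Ded-mono Δ⊆Δ′ (thm g)     = thm g
Ded-mono Δ⊆Δ′ (hyp x)     = hyp (Δ⊆Δ′ x)
Ded-mono Δ⊆Δ′ (mpD d₁ d₂) = mpD (Ded-mono Δ⊆Δ′ d₁) (Ded-mono Δ⊆Δ′ d₂)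

Ded-idem : Ded (Ded Δ) ⊆ Ded Δ
Ded-idem (thm g)     = thm g
Ded-idem (hyp d)     = d
Ded-idem (mpD d₁ d₂) = mpD (Ded-idem d₁) (Ded-idem d₂)

Ded-∅⊆G0 : Ded ∅ ⊆ G0
Ded-∅⊆G0 (thm g)     = g
Ded-∅⊆G0 (mpD d₁ d₂) = mp (Ded-∅⊆G0 d₁) (Ded-∅⊆G0 d₂)

deduction : ∀ {e} → Ded (Δ ∪ ｛ e ｝) φ → Ded Δ (e ⇒ φ)
deduction {e = e} (thm {φ} g)       = mpD (thm (taut (taut-K φ e))) (thm g)
deduction {e = e} (hyp {φ} (inj₁ x)) = mpD (thm (taut (taut-K φ e))) (hyp x)
deduction {e = e} (hyp (inj₂ refl))  = thm (taut (taut-I e))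
deduction {e = e} (mpD {a} {b} d₁ d₂) =
  mpD (mpD (thm (taut (taut-S e a b))) (deduction d₁)) (deduction d₂)

module _ (w : W) where

  Ded⊆mem : Ded (mem w) ⊆ mem w
  Ded⊆mem (thm g)     = containsG0 w g
  Ded⊆mem (hyp x)     = x
  Ded⊆mem (mpD d₁ d₂) = closedMP w (Ded⊆mem d₁) (Ded⊆mem d₂)

  G0-mp : G0 (a ⇒ b) → mem w a → mem w b
  G0-mp g = closedMP w (containsG0 w g)

  G0-mp₂ : G0 (a ⇒ b ⇒ c) → mem w a → mem w b → mem w c
  G0-mp₂ g x = closedMP w (G0-mp g x)

  ⊥∉ : ¬ mem w ⊥'
  ⊥∉ x = consistent w (hyp x)

  mem-¬ : (¬ mem w φ) ⇔ mem w (¬' φ)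
  mem-¬ {φ} = mk⇔ ¬φ-added (λ ¬φ∈ φ∈ → ⊥∉ (G0-mp₂ (taut (taut-explosion φ ⊥')) ¬φ∈ φ∈))
    where
    ¬φ-added : ¬ mem w φ → mem w (¬' φ)
    ¬φ-added φ∉ = maximal w (mem w ∪ ｛ ¬' φ ｝) inj₁ consistent-with-¬φ (inj₂ refl)
      where
      consistent-with-¬φ : Consistent (mem w ∪ ｛ ¬' φ ｝)
      consistent-with-¬φ ⊢⊥ = φ∉ (G0-mp (taut (taut-¬¬-elim φ)) (Ded⊆mem (deduction ⊢⊥)))

  mem-∧ : (mem w a × mem w b) ⇔ mem w (a ∧' b)
  mem-∧ {a} {b} = mk⇔
    (λ (x , y) → G0-mp₂ (taut (taut-∧-intro a b)) x y)
    (λ x → G0-mp (taut (taut-∧-proj₁ a b)) x , G0-mp (taut (taut-∧-proj₂ a b)) x)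

  mem-∨ : Dec (mem w a) → (mem w a ⊎ mem w b) ⇔ mem w (a ∨' b)
  mem-∨ {a} {b} a? = mk⇔ introduce (eliminate a?)
    where
    introduce : mem w a ⊎ mem w b → mem w (a ∨' b)
    introduce (inj₁ x) = G0-mp (taut (taut-∨-inj₁ a b)) x
    introduce (inj₂ y) = G0-mp (taut (taut-∨-inj₂ a b)) y
    eliminate : Dec (mem w a) → mem w (a ∨' b) → mem w a ⊎ mem w b
    eliminate (yes a∈) x = inj₁ a∈
    eliminate (no a∉)  x = inj₂ (G0-mp₂ (taut (taut-∨-syllogism a b)) x (to mem-¬ a∉))

  mem-⇒ : Dec (mem w a) → (mem w a → mem w b) ⇔ mem w (a ⇒ b)
  mem-⇒ {a} {b} a? = mk⇔ (introduce a?) (closedMP w)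
    where
    introduce : Dec (mem w a) → (mem w a → mem w b) → mem w (a ⇒ b)
    introduce (yes a∈) h = G0-mp (taut (taut-K b a)) (h a∈)
    introduce (no a∉)  h = G0-mp (taut (taut-explosion a b)) (to mem-¬ a∉)

  G0-⇔-mp : G0 (a ⇔' b) → mem w a → mem w b
  G0-⇔-mp g = closedMP w (proj₁ (from mem-∧ (containsG0 w g)))

successors : List Fm → Fm → List Fm
successors Fs φ =
  φ ∷ ¬' φ ∷ □ φ ∷ ■ φ ∷ concatMap (λ ψ → (φ ∧' ψ) ∷ (φ ∨' ψ) ∷ (φ ⇒ ψ) ∷ []) Fs

combination-∈ : ∀ {Fs χ} → ψ ∈ Fs → χ ∈ ((φ ∧' ψ) ∷ (φ ∨' ψ) ∷ (φ ⇒ ψ) ∷ []) →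
                χ ∈ successors Fs φ
combination-∈ ψ∈ χ∈ = there (there (there (there (∈-concatMap⁺ _ (lose ψ∈ χ∈)))))

formulas : ℕ → List Fm
formulas zero    = []
formulas (suc k) = var k ∷ ⊥' ∷ concatMap (successors (formulas k)) (formulas k)

formulas-step : ∀ {k χ} → φ ∈ formulas k → χ ∈ successors (formulas k) φ → χ ∈ formulas (suc k)
formulas-step φ∈ χ∈ = there (there (∈-concatMap⁺ _ (lose φ∈ χ∈)))

formulas-mono : ∀ {j k} → j ≤ k → (_∈ formulas j) ⊆ (_∈ formulas k)
formulas-mono = chain-mono (λ k → _∈ formulas k) (λ _ φ∈ → formulas-step φ∈ (here refl))

Listed : Fm → Set
Listed φ = ∃[ k ] φ ∈ formulas k

Listed-successor : ∀ {χ} → (∀ {Fs} → χ ∈ successors Fs φ) → Listed φ → Listed χ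
Listed-successor χ∈ (k , φ∈) = suc k , formulas-step φ∈ (χ∈ {formulas k})

Listed-combination : ∀ {χ} → (∀ {Fs} → ψ ∈ Fs → χ ∈ successors Fs φ) →
                     Listed φ → Listed ψ → Listed χ
Listed-combination χ∈ (k , φ∈) (l , ψ∈) =
  suc (k ⊔ l) ,
  formulas-step (formulas-mono (m≤m⊔n k l) φ∈) (χ∈ (formulas-mono (m≤n⊔m k l) ψ∈))

formulas-complete : ∀ φ → Listed φ
formulas-complete (var q)  = suc q , here refl
formulas-complete ⊥'       = 1 , there (here refl)
formulas-complete (¬' φ)   = Listed-successor (there (here refl)) (formulas-complete φ)
formulas-complete (□ φ)    = Listed-successor (there (there (here refl))) (formulas-complete φ)
formulas-complete (■ φ)    =
  Listed-successor (there (there (there (here refl)))) (formulas-complete φ)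
formulas-complete (φ ∧' ψ) = Listed-combination (λ ψ∈ → combination-∈ ψ∈ (here refl))
  (formulas-complete φ) (formulas-complete ψ)
formulas-complete (φ ∨' ψ) = Listed-combination (λ ψ∈ → combination-∈ ψ∈ (there (here refl)))
  (formulas-complete φ) (formulas-complete ψ)
formulas-complete (φ ⇒ ψ)  = Listed-combination (λ ψ∈ → combination-∈ ψ∈ (there (there (here refl))))
  (formulas-complete φ) (formulas-complete ψ)

addIfConsistent : Fm → Pred Fm 0ℓ → Pred Fm 0ℓ
addIfConsistent e Δ φ = Δ φ ⊎ (e ≡ φ × Consistent (Δ ∪ ｛ e ｝))

addAllIfConsistent : List Fm → Pred Fm 0ℓ → Pred Fm 0ℓ
addAllIfConsistent []       Δ = Δ
addAllIfConsistent (e ∷ es) Δ = addAllIfConsistent es (addIfConsistent e Δ)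

-- Consistency of Δ ∪ {e} cannot be decided, but if adding e led to ⊥ then
-- Δ ∪ {e} is inconsistent, so e was never added.
addIfConsistent-consistent : ∀ e → Consistent Δ → Consistent (addIfConsistent e Δ)
addIfConsistent-consistent {Δ} e consΔ ⊢⊥ = consΔ (Ded-mono e-not-added ⊢⊥)
  where
  ⊆Δ∪e : addIfConsistent e Δ ⊆ Δ ∪ ｛ e ｝
  ⊆Δ∪e (inj₁ x)        = inj₁ x
  ⊆Δ∪e (inj₂ (e≡ , _)) = inj₂ e≡
  e-not-added : addIfConsistent e Δ ⊆ Δ
  e-not-added (inj₁ x)             = x
  e-not-added (inj₂ (_ , consΔ∪e)) = ⊥-elim (consΔ∪e (Ded-mono ⊆Δ∪e ⊢⊥))

addAllIfConsistent-consistent : ∀ es → Consistent Δ → Consistent (addAllIfConsistent es Δ)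
addAllIfConsistent-consistent []       consΔ = consΔ
addAllIfConsistent-consistent (e ∷ es) consΔ =
  addAllIfConsistent-consistent es (addIfConsistent-consistent e consΔ)

⊆-addAllIfConsistent : ∀ es → Δ ⊆ addAllIfConsistent es Δ
⊆-addAllIfConsistent []       x = x
⊆-addAllIfConsistent (e ∷ es) x = ⊆-addAllIfConsistent es (inj₁ x)

addAllIfConsistent-maximal : ∀ {E es} → Consistent E → addAllIfConsistent es Δ ⊆ E →
                             φ ∈ es → E φ → addAllIfConsistent es Δ φ
addAllIfConsistent-maximal {Δ} {E = E} {e ∷ es} consE ⊆E (here refl) φ∈E =
  ⊆-addAllIfConsistent es (inj₂ (refl , λ ⊢⊥ → consE (Ded-mono Δ∪φ⊆E ⊢⊥)))
  where
  Δ∪φ⊆E : Δ ∪ ｛ e ｝ ⊆ E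
  Δ∪φ⊆E (inj₁ x)    = ⊆E (⊆-addAllIfConsistent es (inj₁ x))
  Δ∪φ⊆E (inj₂ refl) = φ∈E
addAllIfConsistent-maximal {es = e ∷ es} consE ⊆E (there φ∈) φ∈E =
  addAllIfConsistent-maximal consE ⊆E φ∈ φ∈E

module Lindenbaum (Δ : Pred Fm 0ℓ) (consΔ : Consistent Δ) where

  stage : ℕ → Pred Fm 0ℓ
  stage zero    = Δ
  stage (suc k) = addAllIfConsistent (formulas k) (stage k)

  stage-consistent : ∀ k → Consistent (stage k)
  stage-consistent zero    = consΔ
  stage-consistent (suc k) = addAllIfConsistent-consistent (formulas k) (stage-consistent k)

  stage-mono : ∀ {j k} → j ≤ k → stage j ⊆ stage k
  stage-mono = chain-mono stage (λ k → ⊆-addAllIfConsistent (formulas k))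

  Γ : Pred Fm 0ℓ
  Γ = ⋃ ℕ stage

  compact : Ded Γ φ → ∃[ k ] Ded (stage k) φ
  compact (thm g)       = 0 , thm g
  compact (hyp (k , x)) = k , hyp x
  compact (mpD d₁ d₂) with compact d₁ | compact d₂
  ... | k , d₁′ | l , d₂′ =
    k ⊔ l , mpD (Ded-mono (stage-mono (m≤m⊔n k l)) d₁′)
                (Ded-mono (stage-mono (m≤n⊔m k l)) d₂′)

  Γ-consistent : Consistent Γ
  Γ-consistent ⊢⊥ = let k , ⊢⊥′ = compact ⊢⊥ in stage-consistent k ⊢⊥′

  Γ-maximal : ∀ E → Ded Γ ⊆ E → Consistent E → E ⊆ Ded Γ
  Γ-maximal E ⊆E consE {φ} φ∈E =
    let k , φ∈ = formulas-complete φ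
    in hyp (suc k , addAllIfConsistent-maximal consE (λ x → ⊆E (hyp (suc k , x))) φ∈ φ∈E)

  theory : W
  theory = record
    { mem        = Ded Γ
    ; containsG0 = thm
    ; closedMP   = mpD
    ; consistent = Γ-consistent ∘ Ded-idem
    ; maximal    = Γ-maximal
    }

lindenbaum : Consistent Δ → Σ[ w ∈ W ] Δ ⊆ mem w
lindenbaum {Δ} consΔ = theory , λ x → hyp (0 , x)
  where open Lindenbaum Δ consΔ

Interior : (W → Set ℓ) → W → Set (lsuc 0ℓ Level.⊔ ℓ)
Interior Q v = Σ[ X ∈ (W → Set) ] (μ X × X v × ((z : W) → X z → Q z))

_∈𝒩_ : (W → Set ℓ) → W → Set (lsuc 0ℓ Level.⊔ ℓ)
Q ∈𝒩 w = Σ[ ψ ∈ Fm ] (hat (■ ψ) w × ((z : W) → hat ψ z ⟺ Q z))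

Interior-cong : {Q : W → Set ℓ} {R : W → Set ℓ′} {v : W} →
                (∀ z → Q z ⇔ R z) → Interior Q v ⇔ Interior R v
Interior-cong Q⇔R = mk⇔
  (λ (X , μX , v∈X , X⊆Q) → X , μX , v∈X , λ z → to (Q⇔R z) ∘ X⊆Q z)
  (λ (X , μX , v∈X , X⊆R) → X , μX , v∈X , λ z → from (Q⇔R z) ∘ X⊆R z)

μ-basic : ∀ φ → μ (hat (□ φ))
μ-basic φ = (φ ≡_) , λ w → mk⟺ (λ □φ∈ → φ , refl , □φ∈) (λ { (_ , refl , □φ∈) → □φ∈ })

module Classical (em : ExcludedMiddle (lsuc 0ℓ)) where

  dec : (Q : Set) → Dec Q
  dec Q = map′ lower lift em

  G0-complete : (∀ w → mem w φ) → G0 φ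
  G0-complete {φ} φ∈ with dec (Ded (∅ ∪ ｛ ¬' φ ｝) ⊥')
  ... | yes ⊢⊥ = mp (taut (taut-¬¬-elim φ)) (Ded-∅⊆G0 (deduction ⊢⊥))
  ... | no cons =
    let w , ⊆w = lindenbaum cons in ⊥-elim (from (mem-¬ w) (⊆w (inj₂ refl)) (φ∈ w))

  G0-⇒-intro : (∀ w → mem w a → mem w b) → G0 (a ⇒ b)
  G0-⇒-intro a⊆b = G0-complete λ w → to (mem-⇒ w (dec _)) (a⊆b w)

  G0-⇔-intro : (∀ w → mem w a ⇔ mem w b) → G0 (a ⇔' b)
  G0-⇔-intro a≡b = G0-complete λ w →
    to (mem-∧ w) (to (mem-⇒ w (dec _)) (to (a≡b w)) , to (mem-⇒ w (dec _)) (from (a≡b w)))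

  □-mono : G0 (a ⇒ b) → ∀ v → mem v (□ a) → mem v (□ b)
  □-mono {a} {b} a⇒b v □a∈ =
    proj₂ (from (mem-∧ v) (G0-mp v axM (G0-⇔-mp v (reB a⇔a∧b) □a∈)))
    where
    a⇔a∧b : G0 (a ⇔' a ∧' b)
    a⇔a∧b = G0-⇔-intro λ w →
      mk⇔ (λ a∈ → to (mem-∧ w) (a∈ , G0-mp w a⇒b a∈)) (proj₁ ∘ from (mem-∧ w))

  Interior-hat : ∀ {v} → Interior (hat φ) v ⇔ mem v (□ φ)
  Interior-hat {φ} {v} =
    mk⇔ □-intro (λ □φ∈ → hat (□ φ) , μ-basic φ , □φ∈ , λ z → G0-mp z axT)
    where
    □-intro : Interior (hat φ) v → mem v (□ φ)
    □-intro (X , (S , X≡⋃) , v∈X , X⊆φ) =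
      let χ , χ∈S , □χ∈v = _⟺_.to (X≡⋃ v) v∈X
          □χ⇒φ = G0-⇒-intro λ z □χ∈z → X⊆φ z (_⟺_.from (X≡⋃ z) (χ , χ∈S , □χ∈z))
      in □-mono □χ⇒φ v (G0-mp v ax4 □χ∈v)

  ∈𝒩-hat : {Q : W → Set ℓ} {w : W} → (∀ z → Q z ⇔ mem z φ) → Q ∈𝒩 w ⇔ mem w (■ φ)
  ∈𝒩-hat {φ = φ} {Q = Q} {w = w} Q≡φ =
    mk⇔ ■-intro (λ ■φ∈ → φ , ■φ∈ , λ z → mk⟺ (from (Q≡φ z)) (to (Q≡φ z)))
    where
    ■-intro : Q ∈𝒩 w → mem w (■ φ)
    ■-intro (ψ , ■ψ∈ , ψ≡Q) =
      G0-⇔-mp w (reBB (G0-⇔-intro λ z → Q≡φ z ⇔-∘ ⟺⇒⇔ (ψ≡Q z))) ■ψ∈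

  module TruthLemma (f : W → W) (isChoice : IsChoice f) where

    truth : ∀ γ w → sat f γ w ⇔ mem w γ
    truth (var q)  w = mk⇔ lower lift
    truth ⊥'       w = mk⇔ (λ { (lift ()) }) (⊥-elim ∘ ⊥∉ w)
    truth (¬' φ)   w = mem-¬ w ⇔-∘ ¬-cong-⇔ (truth φ w)
    truth (φ ∧' ψ) w = mem-∧ w ⇔-∘ (truth φ w ×-⇔ truth ψ w)
    truth (φ ∨' ψ) w = mem-∨ w (dec _) ⇔-∘ (truth φ w ⊎-⇔ truth ψ w)
    truth (φ ⇒ ψ)  w = mem-⇒ w (dec _) ⇔-∘ →-cong-⇔ (truth φ w) (truth ψ w)
    truth (□ φ)    w = Interior-hat ⇔-∘ Interior-cong (λ z → truth φ z)
    truth (■ φ)    w = cases-⇔ em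
      (λ w∈Y₁ → ⟺⇒⇔ (proj₂ (isChoice w w∈Y₁) φ)
                  ⇔-∘ (Interior-hat ⇔-∘ Interior-cong (λ z → truth φ z)))
      (λ _ → ∈𝒩-hat {w = w} (λ z → truth φ z))

mainTheorem1 : ExcludedMiddle (lsuc 0ℓ) → (f : W → W) → IsChoice f →
    (γ : Fm) (w : W) → sat f γ w ⟺ Lift (lsuc 0ℓ) (hat γ w)
mainTheorem1 em f isChoice γ w = mk⟺ (lift ∘ to (truth γ w)) (from (truth γ w) ∘ lower)
  where
  open Classical em
  open TruthLemma f isChoice
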